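{- $[\![\frac1{\sqrt2}\sum_{y_0}e^{2i\pi(\frac18+\frac34y_0)}]\!]=1$. Consequently, for every integer $n\ge1$ and every $t\in\mathrm{SOP}[\frac1{2^n}]$ there exists $t'\in\mathrm{SOP}[\frac1{2^{\max(3,n)}}]'$ with $[\![t]\!]=[\![t']\!]$.
   Context: An SOP morphism $t:n\to m$ is a formal expression $t=s\sum_{\vec y\in V^k}e^{2i\pi P(\vec y)}|\vec O(\vec y)\rangle\langle\vec I(\vec y)|$ where $s\in\mathbb R$, $\vec y=(y_1,\dots,y_k)$ are distinct boolean summation variables, $P\in\mathbb R[\vec y]/(y_j^2-y_j)$, $\vec O\in\mathbb F_2[\vec y]^m$, $\vec I\in\mathbb F_2[\vec y]^n$ (a morphism $0\to0$ with no $|\cdot\rangle\langle\cdot|$ written is a scalar). Interpretation: $[\![t]\!]=s\sum_{\vec y\in\{0,1\}^k}e^{2i\pi P(\vec y)}|\vec O(\vec y)\rangle\langle\vec I(\vec y)|$. For $n\ge1$, $\mathrm{SOP}[\frac1{2^n}]$ is the set of SOP morphisms $\frac1{\sqrt2^{\,p}}\sum_{\vec y}e^{2i\pi\frac{P}{2^n}}|\vec O\rangle\langle\vec I|$ with $p\in\mathbb Z$ and $P$ with integer coefficients, and $\mathrm{SOP}[\frac1{2^n}]'$ is the set of those of the form $\frac1{2^{p}}\sum_{\vec y}e^{2i\pi\frac{P}{2^n}}|\vec O\rangle\langle\vec I|$ with $p\in\mathbb Z$ and $P$ with integer coefficients. -}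

module Defs where

open import Data.Bool using (Bool; true; false; _xor_; _∧_; _∨_; not; if_then_else_)
open import Data.Nat as ℕ using (ℕ; zero; suc; _∸_; _^_)
open import Data.Nat.Properties using (m^n≢0)
open import Data.Integer as ℤ using (ℤ; +_; -[1+_]; _%ℕ_)
open import Data.Rational as ℚ using (ℚ; 0ℚ; 1ℚ; ½)
open import Data.Vec as Vec using (Vec; []; _∷_)
open import Data.List as List using (List; []; _∷_; _++_)
open import Data.Product using (_×_; _,_)
open import Function using (_∘_)
open import Relation.Binary.PropositionalEquality using (_≡_)

-- Multilinear polynomials in boolean variables y₁ … y_k
-- (i.e. elements of R[y]/(y_j² - y_j)).
-- A monomial is the set of variables it contains, given as Vec Bool k.

monoEval : ∀ {k} → Vec Bool k → Vec Bool k → Bool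
monoEval []      []      = true
monoEval (s ∷ S) (b ∷ y) = (not s ∨ b) ∧ monoEval S y

ZPoly : ℕ → Set
ZPoly k = List (ℤ × Vec Bool k)

evalZ : ∀ {k} → ZPoly k → Vec Bool k → ℤ
evalZ []             y = + 0
evalZ ((c , S) ∷ ps) y = (if monoEval S y then c else + 0) ℤ.+ evalZ ps y

F2Poly : ℕ → Set
F2Poly k = List (Vec Bool k)

evalF2 : ∀ {k} → F2Poly k → Vec Bool k → Bool
evalF2 []       y = false
evalF2 (S ∷ ps) y = monoEval S y xor evalF2 ps y

-- SOP morphisms n → m whose scalar is determined by an integer p and whose
-- phase is P / 2^N with P an integer polynomial.  The same raw data is
-- interpreted in two ways:
--   SOP[1/2^N]  :  1/√2^p · Σ_y e^{2iπ P(y)/2^N} |O(y)⟩⟨I(y)|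
--   SOP[1/2^N]' :  1/2^p  · Σ_y e^{2iπ P(y)/2^N} |O(y)⟩⟨I(y)|

record SOP (n m : ℕ) : Set where
  field
    k : ℕ
    p : ℤ
    P : ZPoly k
    O : Vec (F2Poly k) m
    I : Vec (F2Poly k) n

-- Exact complex arithmetic: the cyclotomic field ℚ(ζ) with
-- ζ = e^{2iπ/2^M}, M = L + 3 (so √2 ∈ ℚ(ζ)).  Elements are represented in
-- the ℚ-basis 1, ζ, …, ζ^{d-1}, d = 2^{M-1} = 2^(L+2), using ζ^d = -1.
-- This field embeds into ℂ (ζ ↦ e^{2iπ/2^M}), so equality here is equality
-- of the complex numbers.

dim : ℕ → ℕ
dim L = 2 ^ (L ℕ.+ 2)

Cyc : ℕ → Set
Cyc L = Vec ℚ (dim L)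

zeroC : ∀ L → Cyc L
zeroC L = Vec.replicate _ 0ℚ

addC : ∀ L → Cyc L → Cyc L → Cyc L
addC L = Vec.zipWith ℚ._+_

scaleC : ∀ L → ℚ → Cyc L → Cyc L
scaleC L c = Vec.map (c ℚ.*_)

basisC : ∀ L → ℕ → Cyc L
basisC L r = Vec.tabulate (λ j → if Data.Fin.toℕ j ℕ.≡ᵇ r then 1ℚ else 0ℚ)
  where import Data.Fin

oneC : ∀ L → Cyc L
oneC L = basisC L 0

ζ^ : ∀ L → ℤ → Cyc L
ζ^ L e = let r = _%ℕ_ e (2 ^ (L ℕ.+ 3)) {{m^n≢0 2 (L ℕ.+ 3)}} in
  if r ℕ.<ᵇ dim L then basisC L r else scaleC L (ℚ.- 1ℚ) (basisC L (r ∸ dim L))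

FSum : Set
FSum = List (ℚ × ℤ)

evalFS : ∀ L → FSum → Cyc L
evalFS L []             = zeroC L
evalFS L ((c , e) ∷ xs) = addC L (scaleC L c (ζ^ L e)) (evalFS L xs)

-- √2 = ζ^a + ζ^{-a} with a = 2^L (ζ^a = e^{iπ/4}).
mulSqrt2 : ℕ → FSum → FSum
mulSqrt2 L = List.concatMap (λ { (c , e) → (c , e ℤ.+ + (2 ^ L)) ∷ (c , e ℤ.- + (2 ^ L)) ∷ [] })

mulInvSqrt2 : ℕ → FSum → FSum   -- 1/√2 = √2/2
mulInvSqrt2 L = List.concatMap (λ { (c , e) → (½ ℚ.* c , e ℤ.+ + (2 ^ L)) ∷ (½ ℚ.* c , e ℤ.- + (2 ^ L)) ∷ [] })

iter : ℕ → (FSum → FSum) → FSum → FSum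
iter zero    f x = x
iter (suc n) f x = f (iter n f x)

scaleInvSqrt2^ : ℕ → ℤ → FSum → FSum
scaleInvSqrt2^ L (+ n)    = iter n (mulInvSqrt2 L)
scaleInvSqrt2^ L -[1+ n ] = iter (suc n) (mulSqrt2 L)

scaleInv2^ : ℤ → FSum → FSum
scaleInv2^ (+ n)    = iter n (List.map (λ { (c , e) → (½ ℚ.* c , e) }))
scaleInv2^ -[1+ n ] = iter (suc n) (List.map (λ { (c , e) → ((1ℚ ℚ.+ 1ℚ) ℚ.* c , e) }))

allVecs : (k : ℕ) → List (Vec Bool k)
allVecs zero    = [] ∷ []
allVecs (suc k) = List.map (false ∷_) (allVecs k) ++ List.map (true ∷_) (allVecs k)

eqVec : ∀ {n} → Vec Bool n → Vec Bool n → Bool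
eqVec []      []      = true
eqVec (a ∷ u) (b ∷ v) = not (a xor b) ∧ eqVec u v

-- Interpretation: the matrix entry ⟨o| ⟦t⟧ |i⟩ ∈ ℚ(ζ_{2^(L+3)}), where the
-- phase denominator is 2^N (N ≤ L + 3, so e^{2iπ P/2^N} = ζ^{P · 2^(L+3-N)}).

phaseTerms : ∀ {n m} → ℕ → ℕ → SOP n m → Vec Bool m → Vec Bool n → FSum
phaseTerms L N t o i =
  List.concatMap
    (λ y → if eqVec (Vec.map (λ q → evalF2 q y) O) o ∧ eqVec (Vec.map (λ q → evalF2 q y) I) i
             then (1ℚ , evalZ P y ℤ.* + (2 ^ ((L ℕ.+ 3) ∸ N))) ∷ []
             else [])
    (allVecs k)
  where open SOP t

⟦_⟧[_,_] : ∀ {n m} → SOP n m → (L N : ℕ) → Vec Bool m → Vec Bool n → Cyc L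
⟦ t ⟧[ L , N ] o i = evalFS L (scaleInvSqrt2^ L (SOP.p t) (phaseTerms L N t o i))

⟦_⟧'[_,_] : ∀ {n m} → SOP n m → (L N : ℕ) → Vec Bool m → Vec Bool n → Cyc L
⟦ t ⟧'[ L , N ] o i = evalFS L (scaleInv2^ (SOP.p t) (phaseTerms L N t o i))

-- The specific scalar  1/√2 Σ_{y₀} e^{2iπ(1/8 + 3/4 y₀)}  =  1/√2^1 Σ_{y₀} e^{2iπ (1 + 6 y₀)/2^3},
-- an element of SOP[1/2^3] : 0 → 0.
ω-sop : SOP 0 0
ω-sop = record
  { k = 1
  ; p = + 1
  ; P = (+ 1 , false ∷ []) ∷ (+ 6 , true ∷ []) ∷ []
  ; O = []
  ; I = []
  }

SameMatrix : ∀ L {n m} → (Vec Bool m → Vec Bool n → Cyc L) → (Vec Bool m → Vec Bool n → Cyc L) → Set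
SameMatrix L f g = ∀ o i → f o i ≡ g o i

-- With ζ^a = e^{iπ/4} we have √2 = ζ^a + ζ^{-a}, which is the first claim, and so
-- 1/√2 = ½ (ζ^a + ζ^{-a}).  Hence a scalar √2^m is Σ_{z ∈ {0,1}^m} e^{2iπ Σ_j (1/8 - z_j/4)},
-- and 1/√2^m is 2^{-m} times the same sum.  Adjoining z as m fresh summation variables and adding
-- Σ_j (1/8 - z_j/4) to the phase turns t into an SOP with scalar 2^{-m} (or 1) whose phase has
-- denominator 2^{max(3,n)}.  In the encoding by formal sums of powers of ζ both sides are
-- literally the same formal sum, so no cyclotomic arithmetic is needed.
module Submission where

open import Defs
open import Data.Nat using (ℕ; zero; suc; _≤_; _∸_; _+_; _^_)
open import Data.Product using (_×_; Σ; _,_)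
open import Data.Bool using (Bool; true; false; _xor_; _∧_; _∨_; not; if_then_else_)
open import Data.Nat.Properties using (n∸n≡0)
open import Data.Integer as ℤ using (ℤ; +_; -[1+_])
import Data.Integer.Properties as ℤ
open import Data.Integer.Tactic.RingSolver using (solve-∀)
open import Data.Rational using (ℚ; 1ℚ)
open import Data.Vec as Vec using (Vec; []; _∷_; replicate)
import Data.Vec.Properties as Vec
open import Data.List as List using (List; []; _∷_; _++_; concatMap; [_])
import Data.List.Properties as List
open import Function using (_∘_)
open import Relation.Binary.PropositionalEquality using (_≡_; refl; sym; trans; cong; cong₂; module ≡-Reasoning)

module _ {F G : FSum → FSum} where

  iter-cong : (∀ x → F x ≡ G x) → ∀ m x → iter m F x ≡ iter m G x
  iter-cong F≗G zero    x = refl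
  iter-cong F≗G (suc m) x = trans (F≗G _) (cong G (iter-cong F≗G m x))

  iter-commute : (∀ x → F (G x) ≡ G (F x)) → ∀ m x → iter m F (G x) ≡ G (iter m F x)
  iter-commute FG≡GF zero    x = refl
  iter-commute FG≡GF (suc m) x = trans (cong F (iter-commute FG≡GF m x)) (FG≡GF _)

  iter-∘ : (∀ x → F (G x) ≡ G (F x)) → ∀ m x → iter m (F ∘ G) x ≡ iter m F (iter m G x)
  iter-∘ FG≡GF zero    x = refl
  iter-∘ FG≡GF (suc m) x =
    cong F (trans (cong G (iter-∘ FG≡GF m x)) (sym (iter-commute FG≡GF m (iter m G x))))

iter-suc : ∀ m F (x : FSum) → iter (suc m) F x ≡ iter m F (F x)
iter-suc zero    F x = refl
iter-suc (suc m) F x = cong F (iter-suc m F x)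

module _ (h : ℚ × ℤ → FSum) where

  iter-concatMap-[] : ∀ m → iter m (concatMap h) [] ≡ []
  iter-concatMap-[] zero    = refl
  iter-concatMap-[] (suc m) = cong (concatMap h) (iter-concatMap-[] m)

  iter-concatMap-++ : ∀ m xs ys →
    iter m (concatMap h) (xs ++ ys) ≡ iter m (concatMap h) xs ++ iter m (concatMap h) ys
  iter-concatMap-++ zero    xs ys = refl
  iter-concatMap-++ (suc m) xs ys =
    trans (cong (concatMap h) (iter-concatMap-++ m xs ys))
          (List.concatMap-++ h (iter m (concatMap h) xs) (iter m (concatMap h) ys))

  iter-concatMap-concatMap : ∀ {A : Set} m (G : A → FSum) ys →
    iter m (concatMap h) (concatMap G ys) ≡ concatMap (iter m (concatMap h) ∘ G) ys
  iter-concatMap-concatMap m G []       = iter-concatMap-[] m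
  iter-concatMap-concatMap m G (y ∷ ys) =
    trans (iter-concatMap-++ m (G y) (concatMap G ys))
          (cong (iter m (concatMap h) (G y) ++_) (iter-concatMap-concatMap m G ys))

concatMap-const-[] : ∀ {A B : Set} (xs : List A) → concatMap (λ _ → List.[] {A = B}) xs ≡ []
concatMap-const-[] []       = refl
concatMap-const-[] (_ ∷ xs) = concatMap-const-[] xs

signShift : ∀ {m} → ℤ → ℤ → Vec Bool m → ℤ
signShift a e []       = e
signShift a e (z ∷ zs) = signShift a (if z then e ℤ.- a else e ℤ.+ a) zs

module _ (L : ℕ) where

  iter-mulSqrt2-singleton : ∀ m c e →
    iter m (mulSqrt2 L) [ (c , e) ] ≡ List.map (λ z → (c , signShift (+ 2 ^ L) e z)) (allVecs m)
  iter-mulSqrt2-singleton zero    c e = refl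
  iter-mulSqrt2-singleton (suc m) c e = begin
    iter (suc m) (mulSqrt2 L) [ (c , e) ]
      ≡⟨ iter-suc m (mulSqrt2 L) [ (c , e) ] ⟩
    iter m (mulSqrt2 L) ([ (c , e ℤ.+ a) ] ++ [ (c , e ℤ.- a) ])
      ≡⟨ iter-concatMap-++ _ m [ (c , e ℤ.+ a) ] [ (c , e ℤ.- a) ] ⟩
    iter m (mulSqrt2 L) [ (c , e ℤ.+ a) ] ++ iter m (mulSqrt2 L) [ (c , e ℤ.- a) ]
      ≡⟨ cong₂ _++_ (iter-mulSqrt2-singleton m c (e ℤ.+ a)) (iter-mulSqrt2-singleton m c (e ℤ.- a)) ⟩
    List.map (φ ∘ (false ∷_)) V ++ List.map (φ ∘ (true ∷_)) V
      ≡⟨ cong₂ _++_ (List.map-∘ V) (List.map-∘ V) ⟩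
    List.map φ (List.map (false ∷_) V) ++ List.map φ (List.map (true ∷_) V)
      ≡⟨ List.map-++ φ (List.map (false ∷_) V) (List.map (true ∷_) V) ⟨
    List.map φ (allVecs (suc m)) ∎
    where
      open ≡-Reasoning
      a = + 2 ^ L
      V = allVecs m
      φ : Vec Bool (suc m) → ℚ × ℤ
      φ z = (c , signShift a e z)

  iter-mulSqrt2-if : ∀ m b c e →
    iter m (mulSqrt2 L) (if b then [ (c , e) ] else [])
      ≡ concatMap (λ z → if b then [ (c , signShift (+ 2 ^ L) e z) ] else []) (allVecs m)
  iter-mulSqrt2-if m true  c e =
    trans (iter-mulSqrt2-singleton m c e)
          (trans (sym (List.concatMap-pure _)) (List.concatMap-map [_] _ (allVecs m)))
  iter-mulSqrt2-if m false c e =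
    trans (iter-concatMap-[] _ m) (sym (concatMap-const-[] (allVecs m)))

  mulInvSqrt2≗halve∘mulSqrt2 : ∀ xs → mulInvSqrt2 L xs ≡ scaleInv2^ (+ 1) (mulSqrt2 L xs)
  mulInvSqrt2≗halve∘mulSqrt2 []       = refl
  mulInvSqrt2≗halve∘mulSqrt2 (_ ∷ xs) = cong (λ ys → _ ∷ _ ∷ ys) (mulInvSqrt2≗halve∘mulSqrt2 xs)

  halve-mulSqrt2-commute : ∀ xs →
    scaleInv2^ (+ 1) (mulSqrt2 L xs) ≡ mulSqrt2 L (scaleInv2^ (+ 1) xs)
  halve-mulSqrt2-commute []       = refl
  halve-mulSqrt2-commute (_ ∷ xs) = cong (λ ys → _ ∷ _ ∷ ys) (halve-mulSqrt2-commute xs)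

  iter-mulInvSqrt2 : ∀ m xs → iter m (mulInvSqrt2 L) xs ≡ scaleInv2^ (+ m) (iter m (mulSqrt2 L) xs)
  iter-mulInvSqrt2 m xs =
    trans (iter-cong mulInvSqrt2≗halve∘mulSqrt2 m xs) (iter-∘ halve-mulSqrt2-commute m xs)

padʳ : ∀ {k} m → Vec Bool k → Vec Bool (k + m)
padʳ m S = S Vec.++ replicate m false

padˡ : ∀ {m} k → Vec Bool m → Vec Bool (k + m)
padˡ k S = replicate k false Vec.++ S

monoEval-replicate-false : ∀ {m} (z : Vec Bool m) → monoEval (replicate m false) z ≡ true
monoEval-replicate-false []      = refl
monoEval-replicate-false (_ ∷ z) = monoEval-replicate-false z

monoEval-padʳ : ∀ {k m} (S y : Vec Bool k) (z : Vec Bool m) →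
  monoEval (padʳ m S) (y Vec.++ z) ≡ monoEval S y
monoEval-padʳ []      []      z = monoEval-replicate-false z
monoEval-padʳ (s ∷ S) (b ∷ y) z = cong ((not s ∨ b) ∧_) (monoEval-padʳ S y z)

monoEval-padˡ : ∀ {k m} (y : Vec Bool k) (S z : Vec Bool m) →
  monoEval (padˡ k S) (y Vec.++ z) ≡ monoEval S z
monoEval-padˡ []      S z = refl
monoEval-padˡ (_ ∷ y) S z = monoEval-padˡ y S z

padF2ʳ : ∀ {k} m → F2Poly k → F2Poly (k + m)
padF2ʳ m = List.map (padʳ m)

padZʳ : ∀ {k} m → ZPoly k → ZPoly (k + m)
padZʳ m = List.map (λ (c , S) → (c , padʳ m S))

padZˡ : ∀ {m} k → ZPoly m → ZPoly (k + m)
padZˡ k = List.map (λ (c , S) → (c , padˡ k S))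

scaleZ : ∀ {k} → ℤ → ZPoly k → ZPoly k
scaleZ s = List.map (λ (c , S) → (c ℤ.* s , S))

evalF2-padʳ : ∀ {k m} (q : F2Poly k) y (z : Vec Bool m) → evalF2 (padF2ʳ m q) (y Vec.++ z) ≡ evalF2 q y
evalF2-padʳ []      y z = refl
evalF2-padʳ (S ∷ q) y z = cong₂ _xor_ (monoEval-padʳ S y z) (evalF2-padʳ q y z)

evalZ-padʳ : ∀ {k m} (P : ZPoly k) y (z : Vec Bool m) → evalZ (padZʳ m P) (y Vec.++ z) ≡ evalZ P y
evalZ-padʳ []            y z = refl
evalZ-padʳ ((c , S) ∷ P) y z =
  cong₂ (λ b r → (if b then c else + 0) ℤ.+ r) (monoEval-padʳ S y z) (evalZ-padʳ P y z)

evalZ-padˡ : ∀ {k m} (P : ZPoly m) (y : Vec Bool k) z → evalZ (padZˡ k P) (y Vec.++ z) ≡ evalZ P z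
evalZ-padˡ []            y z = refl
evalZ-padˡ ((c , S) ∷ P) y z =
  cong₂ (λ b r → (if b then c else + 0) ℤ.+ r) (monoEval-padˡ y S z) (evalZ-padˡ P y z)

evalZ-scaleZ : ∀ {k} s (P : ZPoly k) y → evalZ (scaleZ s P) y ≡ evalZ P y ℤ.* s
evalZ-scaleZ s []            y = refl
evalZ-scaleZ s ((c , S) ∷ P) y = begin
  (if monoEval S y then c ℤ.* s else + 0) ℤ.+ evalZ (scaleZ s P) y
    ≡⟨ cong₂ ℤ._+_ (if-*ʳ (monoEval S y)) (evalZ-scaleZ s P y) ⟩
  (if monoEval S y then c else + 0) ℤ.* s ℤ.+ evalZ P y ℤ.* s
    ≡⟨ ℤ.*-distribʳ-+ s (if monoEval S y then c else + 0) (evalZ P y) ⟨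
  ((if monoEval S y then c else + 0) ℤ.+ evalZ P y) ℤ.* s ∎
  where
    open ≡-Reasoning
    if-*ʳ : ∀ b → (if b then c ℤ.* s else + 0) ≡ (if b then c else + 0) ℤ.* s
    if-*ʳ true  = refl
    if-*ʳ false = sym (ℤ.*-zeroˡ s)

evalZ-++ : ∀ {k} (P Q : ZPoly k) y → evalZ (P ++ Q) y ≡ evalZ P y ℤ.+ evalZ Q y
evalZ-++ []            Q y = sym (ℤ.+-identityˡ (evalZ Q y))
evalZ-++ ((c , S) ∷ P) Q y =
  trans (cong (λ r → (if monoEval S y then c else + 0) ℤ.+ r) (evalZ-++ P Q y))
        (sym (ℤ.+-assoc (if monoEval S y then c else + 0) (evalZ P y) (evalZ Q y)))

-- The constant monomial and the monomial z₀ contribute a - 2a z₀ = (-1)^{z₀} a.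
signShiftPoly : ℤ → (m : ℕ) → ZPoly m
signShiftPoly a zero    = []
signShiftPoly a (suc m) =
  (a , replicate (suc m) false) ∷ (ℤ.- (a ℤ.+ a) , true ∷ replicate m false) ∷ padZˡ 1 (signShiftPoly a m)

evalZ-signShiftPoly : ∀ a {m} e (z : Vec Bool m) → e ℤ.+ evalZ (signShiftPoly a m) z ≡ signShift a e z
evalZ-signShiftPoly a e [] = ℤ.+-identityʳ e
evalZ-signShiftPoly a {suc m} e (false ∷ z)
  rewrite monoEval-replicate-false z | evalZ-padˡ (signShiftPoly a m) (false ∷ []) z =
  trans (shift₊ e a _) (evalZ-signShiftPoly a (e ℤ.+ a) z)
  where
    shift₊ : ∀ e a X → e ℤ.+ (a ℤ.+ (+ 0 ℤ.+ X)) ≡ (e ℤ.+ a) ℤ.+ X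
    shift₊ = solve-∀
evalZ-signShiftPoly a {suc m} e (true ∷ z)
  rewrite monoEval-replicate-false z | evalZ-padˡ (signShiftPoly a m) (true ∷ []) z =
  trans (shift₋ e a _) (evalZ-signShiftPoly a (e ℤ.- a) z)
  where
    shift₋ : ∀ e a X → e ℤ.+ (a ℤ.+ (ℤ.- (a ℤ.+ a) ℤ.+ X)) ≡ (e ℤ.- a) ℤ.+ X
    shift₋ = solve-∀

concatMap-allVecs-++ : ∀ {A : Set} k m (G : Vec Bool (k + m) → List A) →
  concatMap G (allVecs (k + m)) ≡ concatMap (λ y → concatMap (λ z → G (y Vec.++ z)) (allVecs m)) (allVecs k)
concatMap-allVecs-++ zero    m G = sym (List.++-identityʳ _)
concatMap-allVecs-++ (suc k) m G = begin
  concatMap G (List.map (false ∷_) W ++ List.map (true ∷_) W)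
    ≡⟨ List.concatMap-++ G (List.map (false ∷_) W) (List.map (true ∷_) W) ⟩
  concatMap G (List.map (false ∷_) W) ++ concatMap G (List.map (true ∷_) W)
    ≡⟨ cong₂ _++_ (split false) (split true) ⟩
  concatMap H (List.map (false ∷_) V) ++ concatMap H (List.map (true ∷_) V)
    ≡⟨ List.concatMap-++ H (List.map (false ∷_) V) (List.map (true ∷_) V) ⟨
  concatMap H (allVecs (suc k)) ∎
  where
    open ≡-Reasoning
    W = allVecs (k + m)
    V = allVecs k
    H : Vec Bool (suc k) → List _
    H y = concatMap (λ z → G (y Vec.++ z)) (allVecs m)
    split : ∀ b → concatMap G (List.map (b ∷_) W) ≡ concatMap H (List.map (b ∷_) V)
    split b = begin
      concatMap G (List.map (b ∷_) W)  ≡⟨ List.concatMap-map G (b ∷_) W ⟩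
      concatMap (G ∘ (b ∷_)) W         ≡⟨ concatMap-allVecs-++ k m (G ∘ (b ∷_)) ⟩
      concatMap (H ∘ (b ∷_)) V         ≡⟨ List.concatMap-map H (b ∷_) V ⟨
      concatMap H (List.map (b ∷_) V)  ∎

-- Over the common denominator 2^(L+3) the phase P/2^N becomes P·2^(L+3-N); the fresh
-- variables carry the factors ζ^{±2^L} = e^{±iπ/4} of √2^m.
expandSqrt2 : ∀ {a b} (L N m : ℕ) → ℤ → SOP a b → SOP a b
expandSqrt2 L N m p′ t = record
  { k = k + m
  ; p = p′
  ; P = padZʳ m (scaleZ (+ 2 ^ ((L + 3) ∸ N)) P) ++ padZˡ k (signShiftPoly (+ 2 ^ L) m)
  ; O = Vec.map (padF2ʳ m) O
  ; I = Vec.map (padF2ʳ m) I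
  }
  where open SOP t

evalF2s-padʳ : ∀ {j k m} (Q : Vec (F2Poly k) j) y (z : Vec Bool m) →
  Vec.map (λ q → evalF2 q (y Vec.++ z)) (Vec.map (padF2ʳ m) Q) ≡ Vec.map (λ q → evalF2 q y) Q
evalF2s-padʳ Q y z = trans (sym (Vec.map-∘ _ _ Q)) (Vec.map-cong (λ q → evalF2-padʳ q y z) Q)

module _ {n₁ n₂} (L N m : ℕ) (p′ : ℤ) (t : SOP n₁ n₂) where
  open SOP t

  evalZ-expandSqrt2 : ∀ y z →
    evalZ (SOP.P (expandSqrt2 L N m p′ t)) (y Vec.++ z)
      ≡ signShift (+ 2 ^ L) (evalZ P y ℤ.* + 2 ^ ((L + 3) ∸ N)) z
  evalZ-expandSqrt2 y z = begin
    evalZ (padZʳ m (scaleZ s P) ++ padZˡ k (signShiftPoly a m)) (y Vec.++ z)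
      ≡⟨ evalZ-++ (padZʳ m (scaleZ s P)) _ (y Vec.++ z) ⟩
    evalZ (padZʳ m (scaleZ s P)) (y Vec.++ z) ℤ.+ evalZ (padZˡ k (signShiftPoly a m)) (y Vec.++ z)
      ≡⟨ cong₂ ℤ._+_ (trans (evalZ-padʳ (scaleZ s P) y z) (evalZ-scaleZ s P y))
                     (evalZ-padˡ (signShiftPoly a m) y z) ⟩
    evalZ P y ℤ.* s ℤ.+ evalZ (signShiftPoly a m) z
      ≡⟨ evalZ-signShiftPoly a (evalZ P y ℤ.* s) z ⟩
    signShift a (evalZ P y ℤ.* s) z ∎
    where
      open ≡-Reasoning
      s = + 2 ^ ((L + 3) ∸ N)
      a = + 2 ^ L

  phaseTerms-expandSqrt2 : ∀ o i →
    iter m (mulSqrt2 L) (phaseTerms L N t o i) ≡ phaseTerms L (L + 3) (expandSqrt2 L N m p′ t) o i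
  phaseTerms-expandSqrt2 o i = begin
    iter m (mulSqrt2 L) (concatMap term (allVecs k))
      ≡⟨ iter-concatMap-concatMap _ m term (allVecs k) ⟩
    concatMap (iter m (mulSqrt2 L) ∘ term) (allVecs k)
      ≡⟨ List.concatMap-cong (λ y → iter-mulSqrt2-if L m (selected y) 1ℚ (exponent y)) (allVecs k) ⟩
    concatMap (λ y → concatMap (λ z → if selected y then [ (1ℚ , signShift (+ 2 ^ L) (exponent y) z) ] else [])
                               (allVecs m))
              (allVecs k)
      ≡⟨ List.concatMap-cong (λ y → List.concatMap-cong (term′-++ y) (allVecs m)) (allVecs k) ⟨
    concatMap (λ y → concatMap (λ z → term′ (y Vec.++ z)) (allVecs m)) (allVecs k)
      ≡⟨ concatMap-allVecs-++ k m term′ ⟨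
    concatMap term′ (allVecs (k + m)) ∎
    where
      open ≡-Reasoning
      t′ = expandSqrt2 L N m p′ t

      selected : Vec Bool k → Bool
      selected y = eqVec (Vec.map (λ q → evalF2 q y) O) o ∧ eqVec (Vec.map (λ q → evalF2 q y) I) i

      exponent : Vec Bool k → ℤ
      exponent y = evalZ P y ℤ.* + 2 ^ ((L + 3) ∸ N)

      term : Vec Bool k → FSum
      term y = if selected y then [ (1ℚ , exponent y) ] else []

      term′ : Vec Bool (k + m) → FSum
      term′ w = if eqVec (Vec.map (λ q → evalF2 q w) (SOP.O t′)) o ∧ eqVec (Vec.map (λ q → evalF2 q w) (SOP.I t′)) i
                then [ (1ℚ , evalZ (SOP.P t′) w ℤ.* + 2 ^ ((L + 3) ∸ (L + 3))) ] else []

      term′-++ : ∀ y z → term′ (y Vec.++ z)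
                 ≡ (if selected y then [ (1ℚ , signShift (+ 2 ^ L) (exponent y) z) ] else [])
      term′-++ y z =
        cong₂ (λ s e → if s then [ (1ℚ , e) ] else [])
          (cong₂ _∧_ (cong (λ v → eqVec v o) (evalF2s-padʳ O y z))
                     (cong (λ v → eqVec v i) (evalF2s-padʳ I y z)))
          (begin
            evalZ (SOP.P t′) (y Vec.++ z) ℤ.* + 2 ^ ((L + 3) ∸ (L + 3))
              ≡⟨ cong (λ d → evalZ (SOP.P t′) (y Vec.++ z) ℤ.* + 2 ^ d) (n∸n≡0 (L + 3)) ⟩
            evalZ (SOP.P t′) (y Vec.++ z) ℤ.* + 1
              ≡⟨ ℤ.*-identityʳ _ ⟩
            evalZ (SOP.P t′) (y Vec.++ z)
              ≡⟨ evalZ-expandSqrt2 y z ⟩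
            signShift (+ 2 ^ L) (exponent y) z ∎)

ω-sop-interpretation : SameMatrix 0 ⟦ ω-sop ⟧[ 0 , 3 ] (λ _ _ → oneC 0)
ω-sop-interpretation [] [] = refl

toDyadicScalar : ∀ {a b} L N (t : SOP a b) →
  Σ (SOP a b) (λ t′ → SameMatrix L ⟦ t ⟧[ L , N ] ⟦ t′ ⟧'[ L , L + 3 ])
toDyadicScalar L N t@record { p = + m } =
  expandSqrt2 L N m (+ m) t , λ o i → cong (evalFS L) (begin
    iter m (mulInvSqrt2 L) (phaseTerms L N t o i)
      ≡⟨ iter-mulInvSqrt2 L m _ ⟩
    scaleInv2^ (+ m) (iter m (mulSqrt2 L) (phaseTerms L N t o i))
      ≡⟨ cong (scaleInv2^ (+ m)) (phaseTerms-expandSqrt2 L N m (+ m) t o i) ⟩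
    scaleInv2^ (+ m) (phaseTerms L (L + 3) (expandSqrt2 L N m (+ m) t) o i) ∎)
  where open ≡-Reasoning
toDyadicScalar L N t@record { p = -[1+ m ] } =
  expandSqrt2 L N (suc m) (+ 0) t , λ o i → cong (evalFS L) (phaseTerms-expandSqrt2 L N (suc m) (+ 0) t o i)

lemma6p4 : SameMatrix 0 ⟦ ω-sop ⟧[ 0 , 3 ] (λ _ _ → oneC 0)
           × (∀ (n : ℕ) → 1 ≤ n → ∀ {a b} (t : SOP a b) →
                Σ (SOP a b) (λ t' → SameMatrix (n ∸ 3) ⟦ t ⟧[ n ∸ 3 , n ] ⟦ t' ⟧'[ n ∸ 3 , n ∸ 3 + 3 ]))
lemma6p4 = ω-sop-interpretation , λ n _ t → toDyadicScalar (n ∸ 3) n t
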